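{- Let $n\ge 2$ and let $P_n$ be the path with vertex set $\{1,2,\ldots,n\}$ and edge set $\{(1,2),(2,3),\ldots,(n-1,n)\}$. Then the total number of spanning rooted forests of $P_n$ is $f=\mathcal F_{2n}$, and for all $i,j\in\{1,\ldots,n\}$ the number $f_{ij}$ of spanning rooted forests of $P_n$ in which $j$ belongs to the tree rooted at $i$ equals $$f_{ij}=\mathcal F_{2\min(i,j)-1}\cdot \mathcal F_{2(n+1-\max(i,j))-1}.$$
   Context: $(\mathcal F_k)_{k\ge0}$ denotes the Fibonacci numbers: $\mathcal F_0=0$, $\mathcal F_1=1$, $\mathcal F_{k+2}=\mathcal F_{k+1}+\mathcal F_k$. A spanning rooted forest of a graph $G$ is a spanning acyclic subgraph of $G$ in which exactly one vertex (the root) is marked in each tree. For vertices $i,j$, $f_{ij}$ is the number of spanning rooted forests in which $i$ and $j$ lie in the same tree and that tree is rooted at $i$ (so $f_{ii}$ counts forests in which $i$ is a root); $f$ is the total number of spanning rooted forests. -}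

module Defs where

open import Data.Nat using (ℕ; zero; suc; _+_)
open import Data.Bool using (Bool; true; false; _∧_; _∨_; not)
open import Data.Fin using (Fin; zero; suc; _<?_)
import Data.Fin as Fin
open import Data.Fin.Properties using () renaming (_≟_ to _≟ᶠ_)
open import Data.Nat using () renaming (_≡ᵇ_ to _==_)
open import Data.List using (List; []; _∷_; map; length; filterᵇ; allFin; cartesianProduct)
open import Data.Bool.ListAction using (any; all)
open import Data.Vec using (Vec; []; _∷_; lookup)
open import Data.Product using (_×_; _,_; proj₁; proj₂)
open import Relation.Nullary.Decidable using (⌊_⌋)

fib : ℕ → ℕ
fib zero = 0
fib (suc zero) = 1
fib (suc (suc k)) = fib (suc k) + fib k

Graph : ℕ → Set
Graph n = List (Fin n × Fin n)

-- The path P_n : vertices 0 … n-1 (standing for 1 … n), edges {k, k+1}.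
pathGraph : (n : ℕ) → Graph n
pathGraph zero = []
pathGraph (suc zero) = []
pathGraph (suc (suc m)) =
  (zero , suc zero) ∷ map (λ e → (suc (proj₁ e) , suc (proj₂ e))) (pathGraph (suc m))

-- A spanning subgraph of G is given by a choice of a subset of its edges.
EdgeSubset : ∀ {n} → Graph n → Set
EdgeSubset G = Vec Bool (length G)

selected : ∀ {n} (G : Graph n) → EdgeSubset G → Graph n
selected [] [] = []
selected (e ∷ G) (true ∷ S) = e ∷ selected G S
selected (e ∷ G) (false ∷ S) = selected G S

_=ᶠ_ : ∀ {n} → Fin n → Fin n → Bool
u =ᶠ v = ⌊ u ≟ᶠ v ⌋

adj : ∀ {n} → Graph n → Fin n → Fin n → Bool
adj H u v = any (λ e → (proj₁ e =ᶠ u ∧ proj₂ e =ᶠ v) ∨ (proj₁ e =ᶠ v ∧ proj₂ e =ᶠ u)) H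

reachWithin : ∀ {n} → Graph n → ℕ → Fin n → Fin n → Bool
reachWithin H zero u v = u =ᶠ v
reachWithin {n} H (suc k) u v =
  reachWithin H k u v ∨ any (λ w → reachWithin H k u w ∧ adj H w v) (allFin n)

-- u and v lie in the same connected component (walks of length ≤ n suffice)
connected : ∀ {n} → Graph n → Fin n → Fin n → Bool
connected {n} H u v = reachWithin H n u v

countᵇ : ∀ {A : Set} → (A → Bool) → List A → ℕ
countᵇ p xs = length (filterᵇ p xs)

-- number of connected components: vertices that are the least vertex of their component
components : ∀ {n} → Graph n → ℕ
components {n} H =
  countᵇ (λ v → not (any (λ u → ⌊ u <? v ⌋ ∧ connected H u v) (allFin n))) (allFin n)

-- H is acyclic (a forest) iff  #edges + #components = #vertices
acyclic : ∀ {n} → Graph n → Bool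
acyclic {n} H = (length H + components H) == n

allVecs : (k : ℕ) → List (Vec Bool k)
allVecs zero = [] ∷ []
allVecs (suc k) = map (true ∷_) (allVecs k) Data.List.++ map (false ∷_) (allVecs k)

-- A candidate rooted spanning forest: an edge subset S and a set R of marked vertices (roots).
Candidate : ∀ {n} → Graph n → Set
Candidate {n} G = EdgeSubset G × Vec Bool n

isRootedForest : ∀ {n} (G : Graph n) → Candidate G → Bool
isRootedForest {n} G (S , R) =
  acyclic (selected G S) ∧
  all (λ v → countᵇ (λ r → lookup R r ∧ connected (selected G S) v r) (allFin n) == 1)
                (allFin n)

rootedForests : ∀ {n} (G : Graph n) → List (Candidate G)
rootedForests {n} G = filterᵇ (isRootedForest G) (cartesianProduct (allVecs (length G)) (allVecs n))

forestCount : ∀ {n} → Graph n → ℕ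
forestCount G = length (rootedForests G)

forestCountAt : ∀ {n} → Graph n → Fin n → Fin n → ℕ
forestCountAt G i j =
  countᵇ (λ F → lookup (proj₂ F) i ∧ connected (selected G (proj₁ F)) i j) (rootedForests G)

-- Edge k of the path joins the vertices k and k + 1, so a spanning subgraph is a string β of edge
-- bits. It is always a forest, and two vertices lie in the same tree iff every edge between them is
-- present. A spanning rooted forest is therefore a pair (β, ρ) of edge and root bits in which every
-- maximal block of vertices joined by present edges carries exactly one root, which an automaton
-- checks from left to right, its state recording whether the current block already has its root.
-- Splitting off the first vertex and the edge after it, the numbers t_k and f_k of accepted words
-- on k + 1 vertices, starting with a block that already has a root (t) or not (f), satisfy
-- t_{k+1} = t_k + f_k and f_{k+1} = t_k + 2 f_k. This step maps consecutive Fibonacci numbers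
-- (F_r, F_{r+1}) to (F_{r+2}, F_{r+3}), and (t_0, f_0) = (F_1, F_2) gives f = f_{n-1} = F_{2n}.
-- Counting only the forests in which i and j lie in the tree rooted at i, the vertices from
-- min(i, j) on contribute (t, f) = (0, x), where x = t_{n-max(i,j)} = F_{2(n+1-max(i,j))-1} counts
-- the ways to go on past max(i, j), and adding the other min(i, j) - 1 vertices by the same step
-- turns f into F_{2min(i,j)-1} x.
module Submission where

open import Defs
open import Data.Nat using (ℕ; suc; _≤_; _*_; _∸_; _⊓_; _⊔_)
open import Data.Fin using (Fin; toℕ)
open import Data.Product using (_×_)
open import Relation.Binary.PropositionalEquality using (_≡_)

open import Algebra.Properties.CommutativeSemigroup using (interchange)
open import Data.Bool using (Bool; true; false; _∧_; _∨_; not; _xor_; T)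
open import Data.Bool.ListAction using (any; all; or)
open import Data.Bool.Properties using (T-∧; T-∨; T-≡; ∧-zeroʳ; ∧-identityʳ)
open import Data.Empty using (⊥-elim)
open import Data.Fin using (zero; suc; fromℕ<; _<?_)
open import Data.Fin.Properties using (toℕ<n; toℕ-fromℕ<; toℕ-injective)
open import Data.List using (List; []; _∷_; length; map; tabulate; allFin; _++_; filterᵇ; cartesianProduct)
open import Data.List.Membership.Propositional using (lose)
open import Data.List.Membership.Propositional.Properties using (∈-allFin)
open import Data.List.Properties using (map-++; map-∘; map-cong; length-map)
open import Data.List.Relation.Unary.Any using (satisfied)
open import Data.List.Relation.Unary.Any.Properties using (any⁺; any⁻)
open import Data.Nat using (zero; _+_; _<_; _≡ᵇ_; _<ᵇ_; z≤n; s≤s; s≤s⁻¹)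
open import Data.Nat.ListAction using (sum)
open import Data.Nat.ListAction.Properties using (sum-++)
open import Data.Nat.Properties
  using ( ≡ᵇ⇒≡; ≡⇒≡ᵇ; <ᵇ⇒<; <⇒<ᵇ; suc-injective; +-suc; +-comm; +-identityʳ; *-suc; *-identityˡ
        ; *-distribʳ-+; +-∸-assoc; ≤-trans; ≤-<-trans; ≤-total; <⇒≤; m≤n+m; n≤1+n; n<1+n
        ; m<n⇒m<1+n; m∸n≤m; m∸n+n≡m; ⊔-lub; +-commutativeSemigroup )
open import Data.Product using (_,_; proj₁; proj₂; ∃-syntax)
open import Data.Product.Function.NonDependent.Propositional using (_×-⇔_)
open import Data.Sum using (_⊎_; inj₁; inj₂)
open import Data.Sum.Function.Propositional using (_⊎-⇔_)
open import Data.Vec using (Vec; []; _∷_; toList; lookup)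
open import Data.Vec.Properties using (length-toList)
open import Function using (id; _∘_; _⇔_; mk⇔; Equivalence)
open import Function.Properties.Equivalence using () renaming (trans to ⇔-trans)
open import Relation.Binary.PropositionalEquality using (refl; sym; trans; cong; cong₂; subst; module ≡-Reasoning)
open import Relation.Nullary.Decidable using (⌊_⌋; toWitness; fromWitness; isYes≗does)

-- Bounded quantifiers over ℕ and lists

𝟙 : Bool → ℕ
𝟙 true = 1
𝟙 false = 0

T-⇔⇒≡ : ∀ {x y} → T x ⇔ T y → x ≡ y
T-⇔⇒≡ {false} {false} _ = refl
T-⇔⇒≡ {false} {true} x⇔y = ⊥-elim (Equivalence.from x⇔y _)
T-⇔⇒≡ {true} {false} x⇔y = ⊥-elim (Equivalence.to x⇔y _)
T-⇔⇒≡ {true} {true} _ = refl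

≡ᵇ⇔≡ : ∀ {m n} → T (m ≡ᵇ n) ⇔ m ≡ n
≡ᵇ⇔≡ = mk⇔ (≡ᵇ⇒≡ _ _) (≡⇒≡ᵇ _ _)

∧-dup : ∀ x y → x ∧ (x ∧ y) ≡ x ∧ y
∧-dup true y = refl
∧-dup false y = refl

bit : List Bool → ℕ → Bool
bit [] _ = false
bit (b ∷ bs) zero = b
bit (b ∷ bs) (suc k) = bit bs k

anyBelow allBelow : ℕ → (ℕ → Bool) → Bool
anyBelow zero p = false
anyBelow (suc n) p = p 0 ∨ anyBelow n (p ∘ suc)
allBelow zero p = true
allBelow (suc n) p = p 0 ∧ allBelow n (p ∘ suc)

countBelow : ℕ → (ℕ → Bool) → ℕ
countBelow zero p = 0
countBelow (suc n) p = 𝟙 (p 0) + countBelow n (p ∘ suc)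

anyBelow⁺ : ∀ {n} p {k} → k < n → T (p k) → T (anyBelow n p)
anyBelow⁺ p {zero} (s≤s _) pk = Equivalence.from T-∨ (inj₁ pk)
anyBelow⁺ p {suc k} (s≤s k<n) pk = Equivalence.from (T-∨ {p 0}) (inj₂ (anyBelow⁺ (p ∘ suc) k<n pk))

anyBelow⁻ : ∀ n p → T (anyBelow n p) → ∃[ k ] k < n × T (p k)
anyBelow⁻ (suc n) p any-p with Equivalence.to (T-∨ {p 0}) any-p
... | inj₁ p0 = 0 , s≤s z≤n , p0
... | inj₂ any-p∘suc with anyBelow⁻ n (p ∘ suc) any-p∘suc
...   | k , k<n , pk = suc k , s≤s k<n , pk

anyBelow-false : ∀ n {p} → (∀ k → p k ≡ false) → anyBelow n p ≡ false
anyBelow-false zero _ = refl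
anyBelow-false (suc n) p≡false = cong₂ _∨_ (p≡false 0) (anyBelow-false n (p≡false ∘ suc))

allBelow-cong : ∀ n {p q} → (∀ k → k < n → p k ≡ q k) → allBelow n p ≡ allBelow n q
allBelow-cong zero _ = refl
allBelow-cong (suc n) p≡q = cong₂ _∧_ (p≡q 0 (s≤s z≤n)) (allBelow-cong n λ k k<n → p≡q (suc k) (s≤s k<n))

countBelow-cong : ∀ n {p q} → (∀ k → k < n → p k ≡ q k) → countBelow n p ≡ countBelow n q
countBelow-cong zero _ = refl
countBelow-cong (suc n) p≡q =
  cong₂ _+_ (cong 𝟙 (p≡q 0 (s≤s z≤n))) (countBelow-cong n λ k k<n → p≡q (suc k) (s≤s k<n))

countBelow-false : ∀ n {p} → (∀ k → p k ≡ false) → countBelow n p ≡ 0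
countBelow-false zero _ = refl
countBelow-false (suc n) p≡false = cong₂ _+_ (cong 𝟙 (p≡false 0)) (countBelow-false n (p≡false ∘ suc))

countBelow-complement : ∀ n p → countBelow n p + countBelow n (not ∘ p) ≡ n
countBelow-complement zero p = refl
countBelow-complement (suc n) p with p 0 | countBelow-complement n (p ∘ suc)
... | true | eq = cong suc eq
... | false | eq = trans (+-suc _ _) (cong suc eq)

countᵇ-∷ : ∀ {A : Set} (p : A → Bool) x xs → countᵇ p (x ∷ xs) ≡ 𝟙 (p x) + countᵇ p xs
countᵇ-∷ p x xs with p x
... | true = refl
... | false = refl

countᵇ-sum : ∀ {A : Set} (p : A → Bool) xs → countᵇ p xs ≡ sum (map (𝟙 ∘ p) xs)
countᵇ-sum p [] = refl
countᵇ-sum p (x ∷ xs) = trans (countᵇ-∷ p x xs) (cong (𝟙 (p x) +_) (countᵇ-sum p xs))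

countᵇ-filterᵇ : ∀ {A : Set} (p q : A → Bool) xs →
                 countᵇ q (filterᵇ p xs) ≡ countᵇ (λ x → p x ∧ q x) xs
countᵇ-filterᵇ p q [] = refl
countᵇ-filterᵇ p q (x ∷ xs) =
  trans head (trans (cong (𝟙 (p x ∧ q x) +_) (countᵇ-filterᵇ p q xs))
                    (sym (countᵇ-∷ (λ y → p y ∧ q y) x xs)))
  where
  head : countᵇ q (filterᵇ p (x ∷ xs)) ≡ 𝟙 (p x ∧ q x) + countᵇ q (filterᵇ p xs)
  head with p x
  ... | true = countᵇ-∷ q x (filterᵇ p xs)
  ... | false = refl

any-cong : ∀ {A : Set} {p q : A → Bool} → (∀ x → p x ≡ q x) → ∀ xs → any p xs ≡ any q xs
any-cong p≡q xs = cong or (map-cong p≡q xs)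

any-map : ∀ {A B : Set} (p : B → Bool) (f : A → B) xs → any p (map f xs) ≡ any (p ∘ f) xs
any-map p f xs = cong or (sym (map-∘ xs))

any-tabulate : ∀ {A : Set} {n} (f : Fin n → A) {p : A → Bool} (q : ℕ → Bool) →
               (∀ i → p (f i) ≡ q (toℕ i)) → any p (tabulate f) ≡ anyBelow n q
any-tabulate {n = zero} f q eq = refl
any-tabulate {n = suc n} f q eq = cong₂ _∨_ (eq zero) (any-tabulate (f ∘ suc) (q ∘ suc) (eq ∘ suc))

all-tabulate : ∀ {A : Set} {n} (f : Fin n → A) {p : A → Bool} (q : ℕ → Bool) →
               (∀ i → p (f i) ≡ q (toℕ i)) → all p (tabulate f) ≡ allBelow n q
all-tabulate {n = zero} f q eq = refl
all-tabulate {n = suc n} f q eq = cong₂ _∧_ (eq zero) (all-tabulate (f ∘ suc) (q ∘ suc) (eq ∘ suc))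

countᵇ-tabulate : ∀ {A : Set} {n} (f : Fin n → A) {p : A → Bool} (q : ℕ → Bool) →
                  (∀ i → p (f i) ≡ q (toℕ i)) → countᵇ p (tabulate f) ≡ countBelow n q
countᵇ-tabulate {n = zero} f q eq = refl
countᵇ-tabulate {n = suc n} f {p} q eq =
  trans (countᵇ-∷ p (f zero) _)
        (cong₂ _+_ (cong 𝟙 (eq zero)) (countᵇ-tabulate (f ∘ suc) (q ∘ suc) (eq ∘ suc)))

sum-map-+ : ∀ {A : Set} (f g : A → ℕ) xs → sum (map (λ x → f x + g x) xs) ≡ sum (map f xs) + sum (map g xs)
sum-map-+ f g [] = refl
sum-map-+ f g (x ∷ xs) =
  trans (cong (f x + g x +_) (sum-map-+ f g xs)) (interchange +-commutativeSemigroup (f x) (g x) _ _)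

sum-map-0 : ∀ {A : Set} (xs : List A) → sum (map (λ _ → 0) xs) ≡ 0
sum-map-0 [] = refl
sum-map-0 (x ∷ xs) = sum-map-0 xs

sum-cartesianProduct : ∀ {A B : Set} (g : A × B → ℕ) xs ys →
                       sum (map g (cartesianProduct xs ys)) ≡ sum (map (λ x → sum (map (λ y → g (x , y)) ys)) xs)
sum-cartesianProduct g [] ys = refl
sum-cartesianProduct g (x ∷ xs) ys = begin
  sum (map g (map (x ,_) ys ++ cartesianProduct xs ys))
    ≡⟨ cong sum (map-++ g (map (x ,_) ys) _) ⟩
  sum (map g (map (x ,_) ys) ++ map g (cartesianProduct xs ys))
    ≡⟨ sum-++ (map g (map (x ,_) ys)) _ ⟩
  sum (map g (map (x ,_) ys)) + sum (map g (cartesianProduct xs ys))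
    ≡⟨ cong₂ _+_ (cong sum (sym (map-∘ ys))) (sum-cartesianProduct g xs ys) ⟩
  sum (map (λ y → g (x , y)) ys) + sum (map (λ x → sum (map (λ y → g (x , y)) ys)) xs) ∎
  where open ≡-Reasoning

-- selected for a list of bits, which unlike an EdgeSubset does not change type under map.
select : ∀ {A : Set} → List A → List Bool → List A
select [] _ = []
select (x ∷ xs) [] = []
select (x ∷ xs) (true ∷ bs) = x ∷ select xs bs
select (x ∷ xs) (false ∷ bs) = select xs bs

select-map : ∀ {A B : Set} (f : A → B) xs bs → select (map f xs) bs ≡ map f (select xs bs)
select-map f [] bs = refl
select-map f (x ∷ xs) [] = refl
select-map f (x ∷ xs) (true ∷ bs) = cong (f x ∷_) (select-map f xs bs)
select-map f (x ∷ xs) (false ∷ bs) = select-map f xs bs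

selected-select : ∀ {n} (G : Graph n) S → selected G S ≡ select G (toList S)
selected-select [] [] = refl
selected-select (e ∷ G) (true ∷ S) = cong (e ∷_) (selected-select G S)
selected-select (e ∷ G) (false ∷ S) = selected-select G S

length-selected : ∀ {n} (G : Graph n) S → length (selected G S) ≡ countBelow (length G) (bit (toList S))
length-selected [] [] = refl
length-selected (e ∷ G) (true ∷ S) = cong suc (length-selected G S)
length-selected (e ∷ G) (false ∷ S) = length-selected G S

lookup-bit : ∀ {n} (R : Vec Bool n) i → lookup R i ≡ bit (toList R) (toℕ i)
lookup-bit (b ∷ R) zero = refl
lookup-bit (b ∷ R) (suc i) = lookup-bit R i

=ᶠ-toℕ : ∀ {n} (u v : Fin n) → (u =ᶠ v) ≡ (toℕ u ≡ᵇ toℕ v)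
=ᶠ-toℕ u v =
  T-⇔⇒≡ (mk⇔ (≡⇒≡ᵇ _ _ ∘ cong toℕ ∘ toWitness) (fromWitness ∘ toℕ-injective ∘ ≡ᵇ⇒≡ _ _))

<?-toℕ : ∀ {n} (u v : Fin n) → ⌊ u <? v ⌋ ≡ (toℕ u <ᵇ toℕ v)
<?-toℕ u v = isYes≗does (u <? v)

-- Connectivity along a path

-- T (linked β x y): every edge between x and y is present, edge k joining k and k + 1.
linked : (ℕ → Bool) → ℕ → ℕ → Bool
linked β zero y = allBelow y β
linked β (suc x) zero = allBelow (suc x) β
linked β (suc x) (suc y) = linked (β ∘ suc) x y

linked-refl : ∀ β x → T (linked β x x)
linked-refl β zero = _
linked-refl β (suc x) = linked-refl (β ∘ suc) x

linked-sym : ∀ β x y → linked β x y ≡ linked β y x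
linked-sym β zero zero = refl
linked-sym β zero (suc y) = refl
linked-sym β (suc x) zero = refl
linked-sym β (suc x) (suc y) = linked-sym (β ∘ suc) x y

linked-zeroʳ : ∀ β x → linked β x 0 ≡ allBelow x β
linked-zeroʳ β zero = refl
linked-zeroʳ β (suc x) = refl

linked-step : ∀ β x → linked β x (suc x) ≡ β x
linked-step β zero = ∧-identityʳ (β 0)
linked-step β (suc x) = linked-step (β ∘ suc) x

allBelow-split : ∀ β {y z} → y ≤ z → T (allBelow z β) → T (allBelow y β) × T (linked β y z)
allBelow-split β z≤n below-z = _ , below-z
allBelow-split β (s≤s y≤z) below-z with Equivalence.to (T-∧ {β 0}) below-z
... | β0 , rest with allBelow-split (β ∘ suc) y≤z rest
...   | below-y , y-z = Equivalence.from T-∧ (β0 , below-y) , y-z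

linked-split : ∀ β {x y z} → x ≤ y → y ≤ z → T (linked β x z) → T (linked β x y) × T (linked β y z)
linked-split β {zero} _ = allBelow-split β
linked-split β {suc x} (s≤s x≤y) (s≤s y≤z) = linked-split (β ∘ suc) x≤y y≤z

allBelow-linked : ∀ β y z → T (allBelow y β) → T (linked β y z) → T (allBelow z β)
allBelow-linked β zero z _ y-z = y-z
allBelow-linked β (suc y) zero _ _ = _
allBelow-linked β (suc y) (suc z) below-y y-z with Equivalence.to (T-∧ {β 0}) below-y
... | β0 , rest = Equivalence.from T-∧ (β0 , allBelow-linked (β ∘ suc) y z rest y-z)

allBelow-both : ∀ β y z → T (allBelow y β) → T (allBelow z β) → T (linked β y z)
allBelow-both β zero z _ below-z = below-z
allBelow-both β (suc y) zero below-y _ = below-y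
allBelow-both β (suc y) (suc z) below-y below-z =
  allBelow-both (β ∘ suc) y z (proj₂ (Equivalence.to (T-∧ {β 0}) below-y))
                              (proj₂ (Equivalence.to (T-∧ {β 0}) below-z))

linked-trans : ∀ β x y z → T (linked β x y) → T (linked β y z) → T (linked β x z)
linked-trans β zero y z = allBelow-linked β y z
linked-trans β (suc x) zero zero x-y _ = x-y
linked-trans β (suc x) zero (suc z) x-y y-z =
  allBelow-both (β ∘ suc) x z (proj₂ (Equivalence.to (T-∧ {β 0}) x-y))
                              (proj₂ (Equivalence.to (T-∧ {β 0}) y-z))
linked-trans β (suc x) (suc y) zero x-y y-z with Equivalence.to (T-∧ {β 0}) y-z
... | β0 , rest =
  Equivalence.from T-∧ (β0 , allBelow-linked (β ∘ suc) y x rest (subst T (linked-sym (β ∘ suc) x y) x-y))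
linked-trans β (suc x) (suc y) (suc z) = linked-trans (β ∘ suc) x y z

PathEdge : (ℕ → Bool) → ℕ → ℕ → Set
PathEdge β x y = y ≡ suc x × T (β x)

linked-PathEdge : ∀ β {x y} → y ≡ suc x → T (linked β x y) → PathEdge β x y
linked-PathEdge β {x} refl x-y = refl , subst T (linked-step β x) x-y

PathEdge-linked : ∀ β {x y} → PathEdge β x y ⊎ PathEdge β y x → T (linked β x y)
PathEdge-linked β {x} (inj₁ (refl , βx)) = subst T (sym (linked-step β x)) βx
PathEdge-linked β {y = y} (inj₂ (refl , βy)) = subst T (sym (trans (linked-sym β (suc y) y) (linked-step β y))) βy

reachWithin-mono : ∀ {n} (H : Graph n) {k l u v} → k ≤ l → T (reachWithin H k u v) → T (reachWithin H l u v)
reachWithin-mono H {k} {l} {u} {v} k≤l k-walk =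
  subst (λ j → T (reachWithin H j u v)) (m∸n+n≡m k≤l) (longer (l ∸ k))
  where
  longer : ∀ d → T (reachWithin H (d + k) u v)
  longer zero = k-walk
  longer (suc d) = Equivalence.from T-∨ (inj₁ (longer d))

reachWithin-snoc : ∀ {n} (H : Graph n) k {u w v} → T (reachWithin H k u w) → T (adj H w v) →
                   T (reachWithin H (suc k) u v)
reachWithin-snoc H k {u} {w} u-w w-v =
  Equivalence.from (T-∨ {reachWithin H k u _})
                   (inj₂ (any⁺ _ (lose (∈-allFin w) (Equivalence.from T-∧ (u-w , w-v)))))

reachWithin-induction : ∀ {n} (H : Graph n) (P : Fin n → Set) {u} → P u →
                        (∀ {w v} → P w → T (adj H w v) → P v) →
                        ∀ k {v} → T (reachWithin H k u v) → P v
reachWithin-induction H P Pu step zero u-v = subst P (toWitness u-v) Pu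
reachWithin-induction H P {u} Pu step (suc k) {v} u-v with Equivalence.to (T-∨ {reachWithin H k u v}) u-v
... | inj₁ shorter = reachWithin-induction H P Pu step k shorter
... | inj₂ through with satisfied (any⁻ (λ w → reachWithin H k u w ∧ adj H w v) (allFin _) through)
...   | w , u-w∧w-v with Equivalence.to (T-∧ {reachWithin H k u w}) u-w∧w-v
...     | u-w , w-v = step (reachWithin-induction H P Pu step k u-w) w-v

-- Spanning subgraphs of the path

length-pathGraph : ∀ m → length (pathGraph (suc m)) ≡ m
length-pathGraph zero = refl
length-pathGraph (suc m) = cong suc (trans (length-map _ (pathGraph (suc m))) (length-pathGraph m))

any-selectPath : ∀ m bs (q : ℕ → ℕ → Bool) →
                 any (λ e → q (toℕ (proj₁ e)) (toℕ (proj₂ e))) (select (pathGraph (suc m)) bs)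
                   ≡ anyBelow m (λ k → bit bs k ∧ q k (suc k))
any-selectPath zero bs q = refl
any-selectPath (suc m) [] q = sym (anyBelow-false (suc m) {λ k → bit [] k ∧ q k (suc k)} λ _ → refl)
any-selectPath (suc m) (b ∷ bs) q = trans (firstEdge b) (cong ((b ∧ q 0 1) ∨_) otherEdges)
  where
  shift : Fin (suc m) × Fin (suc m) → Fin (suc (suc m)) × Fin (suc (suc m))
  shift e = suc (proj₁ e) , suc (proj₂ e)
  p : Fin (suc (suc m)) × Fin (suc (suc m)) → Bool
  p e = q (toℕ (proj₁ e)) (toℕ (proj₂ e))
  firstEdge : ∀ b → any p (select (pathGraph (suc (suc m))) (b ∷ bs))
                    ≡ (b ∧ q 0 1) ∨ any p (select (map shift (pathGraph (suc m))) bs)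
  firstEdge true = refl
  firstEdge false = refl
  otherEdges : any p (select (map shift (pathGraph (suc m))) bs)
               ≡ anyBelow m (λ k → bit bs k ∧ q (suc k) (suc (suc k)))
  otherEdges = trans (cong (any p) (select-map shift (pathGraph (suc m)) bs))
                     (trans (any-map p shift (select (pathGraph (suc m)) bs))
                            (any-selectPath m bs λ x y → q (suc x) (suc y)))

joins : ℕ → ℕ → ℕ → ℕ → Bool
joins x y a b = ((a ≡ᵇ x) ∧ (b ≡ᵇ y)) ∨ ((a ≡ᵇ y) ∧ (b ≡ᵇ x))

joins⇔ : ∀ x y a b → T (joins x y a b) ⇔ ((a ≡ x × b ≡ y) ⊎ (a ≡ y × b ≡ x))
joins⇔ x y a b =
  ⇔-trans T-∨ (⇔-trans T-∧ (≡ᵇ⇔≡ ×-⇔ ≡ᵇ⇔≡) ⊎-⇔ ⇔-trans T-∧ (≡ᵇ⇔≡ ×-⇔ ≡ᵇ⇔≡))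

module _ (m : ℕ) (S : EdgeSubset (pathGraph (suc m))) where

  private
    H = selected (pathGraph (suc m)) S
    β = bit (toList S)

  adj-pathSubgraph-anyBelow : ∀ u v → adj H u v ≡ anyBelow m (λ k → β k ∧ joins (toℕ u) (toℕ v) k (suc k))
  adj-pathSubgraph-anyBelow u v = begin
    adj H u v
      ≡⟨ any-cong (λ e → cong₂ _∨_ (cong₂ _∧_ (=ᶠ-toℕ (proj₁ e) u) (=ᶠ-toℕ (proj₂ e) v))
                                   (cong₂ _∧_ (=ᶠ-toℕ (proj₁ e) v) (=ᶠ-toℕ (proj₂ e) u))) H ⟩
    any (λ e → joins (toℕ u) (toℕ v) (toℕ (proj₁ e)) (toℕ (proj₂ e))) H
      ≡⟨ cong (any _) (selected-select (pathGraph (suc m)) S) ⟩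
    any (λ e → joins (toℕ u) (toℕ v) (toℕ (proj₁ e)) (toℕ (proj₂ e))) (select (pathGraph (suc m)) (toList S))
      ≡⟨ any-selectPath m (toList S) (joins (toℕ u) (toℕ v)) ⟩
    anyBelow m (λ k → β k ∧ joins (toℕ u) (toℕ v) k (suc k)) ∎
    where open ≡-Reasoning

  adj-pathSubgraph : ∀ u v → T (adj H u v) ⇔ (PathEdge β (toℕ u) (toℕ v) ⊎ PathEdge β (toℕ v) (toℕ u))
  adj-pathSubgraph u v =
    mk⇔ (to ∘ anyBelow⁻ m _ ∘ subst T (adj-pathSubgraph-anyBelow u v))
        (subst T (sym (adj-pathSubgraph-anyBelow u v)) ∘ from)
    where
    x = toℕ u
    y = toℕ v
    to : ∃[ k ] k < m × T (β k ∧ joins x y k (suc k)) → PathEdge β x y ⊎ PathEdge β y x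
    to (k , _ , βk∧joins) with Equivalence.to (T-∧ {β k}) βk∧joins
    ... | βk , joins-k with Equivalence.to (joins⇔ x y k (suc k)) joins-k
    ...   | inj₁ (refl , 1+x≡y) = inj₁ (sym 1+x≡y , βk)
    ...   | inj₂ (refl , 1+y≡x) = inj₂ (sym 1+y≡x , βk)
    from : PathEdge β x y ⊎ PathEdge β y x → T (anyBelow m (λ k → β k ∧ joins x y k (suc k)))
    from (inj₁ (y≡1+x , βx)) = anyBelow⁺ _ (s≤s⁻¹ (subst (_< suc m) y≡1+x (toℕ<n v)))
      (Equivalence.from T-∧ (βx , Equivalence.from (joins⇔ x y x (suc x)) (inj₁ (refl , sym y≡1+x))))
    from (inj₂ (x≡1+y , βy)) = anyBelow⁺ _ (s≤s⁻¹ (subst (_< suc m) x≡1+y (toℕ<n u)))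
      (Equivalence.from T-∧ (βy , Equivalence.from (joins⇔ x y y (suc y)) (inj₂ (refl , sym x≡1+y))))

  reachWithin-ascending : ∀ d (u v : Fin (suc m)) → toℕ v ≡ d + toℕ u → T (linked β (toℕ u) (toℕ v)) →
                          T (reachWithin H d u v)
  reachWithin-ascending zero u v v≡u _ = fromWitness (toℕ-injective (sym v≡u))
  reachWithin-ascending (suc d) u v v≡1+d+u u-v =
    reachWithin-snoc H d (reachWithin-ascending d u w w≡d+u (proj₁ split))
      (Equivalence.from (adj-pathSubgraph w v) (inj₁ (linked-PathEdge β v≡1+w (proj₂ split))))
    where
    w = fromℕ< (subst (_≤ suc m) v≡1+d+u (<⇒≤ (toℕ<n v)))
    w≡d+u : toℕ w ≡ d + toℕ u
    w≡d+u = toℕ-fromℕ< _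
    v≡1+w : toℕ v ≡ suc (toℕ w)
    v≡1+w = trans v≡1+d+u (cong suc (sym w≡d+u))
    split = linked-split β (subst (toℕ u ≤_) (sym w≡d+u) (m≤n+m (toℕ u) d))
                           (subst (toℕ w ≤_) (sym v≡1+w) (n≤1+n (toℕ w))) u-v

  reachWithin-descending : ∀ d (u v : Fin (suc m)) → toℕ u ≡ d + toℕ v → T (linked β (toℕ v) (toℕ u)) →
                           T (reachWithin H d u v)
  reachWithin-descending zero u v u≡v _ = fromWitness (toℕ-injective u≡v)
  reachWithin-descending (suc d) u v u≡1+d+v v-u =
    reachWithin-snoc H d (reachWithin-descending d u w u≡d+w (proj₂ split))
      (Equivalence.from (adj-pathSubgraph w v) (inj₂ (linked-PathEdge β w≡1+v (proj₁ split))))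
    where
    1+v≤u : suc (toℕ v) ≤ toℕ u
    1+v≤u = subst (suc (toℕ v) ≤_) (sym u≡1+d+v) (s≤s (m≤n+m (toℕ v) d))
    w<1+m : suc (toℕ v) < suc m
    w<1+m = ≤-<-trans 1+v≤u (toℕ<n u)
    w = fromℕ< w<1+m
    w≡1+v : toℕ w ≡ suc (toℕ v)
    w≡1+v = toℕ-fromℕ< w<1+m
    u≡d+w : toℕ u ≡ d + toℕ w
    u≡d+w = trans u≡1+d+v (trans (sym (+-suc d (toℕ v))) (cong (d +_) (sym w≡1+v)))
    split = linked-split β (subst (toℕ v ≤_) (sym w≡1+v) (n≤1+n (toℕ v)))
                           (subst (_≤ toℕ u) (sym w≡1+v) 1+v≤u) v-u

  connected-pathSubgraph : ∀ (u v : Fin (suc m)) → connected H u v ≡ linked β (toℕ u) (toℕ v)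
  connected-pathSubgraph u v = T-⇔⇒≡ (mk⇔ sound complete)
    where
    sound : T (connected H u v) → T (linked β (toℕ u) (toℕ v))
    sound = reachWithin-induction H (λ w → T (linked β (toℕ u) (toℕ w))) (linked-refl β (toℕ u))
              (λ {w} {x} u-w w-x → linked-trans β (toℕ u) (toℕ w) (toℕ x) u-w
                                     (PathEdge-linked β (Equivalence.to (adj-pathSubgraph w x) w-x)))
              (suc m)
    complete : T (linked β (toℕ u) (toℕ v)) → T (connected H u v)
    complete u-v with ≤-total (toℕ u) (toℕ v)
    ... | inj₁ u≤v = reachWithin-mono H (≤-trans (m∸n≤m (toℕ v) (toℕ u)) (<⇒≤ (toℕ<n v)))
                       (reachWithin-ascending (toℕ v ∸ toℕ u) u v (sym (m∸n+n≡m u≤v)) u-v)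
    ... | inj₂ v≤u = reachWithin-mono H (≤-trans (m∸n≤m (toℕ u) (toℕ v)) (<⇒≤ (toℕ<n u)))
                       (reachWithin-descending (toℕ u ∸ toℕ v) u v (sym (m∸n+n≡m v≤u))
                         (subst T (linked-sym β (toℕ u) (toℕ v)) u-v))

  hasSmallerLinked : ∀ y → y < m → anyBelow (suc m) (λ x → (x <ᵇ suc y) ∧ linked β x (suc y)) ≡ β y
  hasSmallerLinked y y<m = T-⇔⇒≡ (mk⇔ to from)
    where
    smallerLinked : ℕ → Bool
    smallerLinked x = (x <ᵇ suc y) ∧ linked β x (suc y)
    to : T (anyBelow (suc m) smallerLinked) → T (β y)
    to found with anyBelow⁻ (suc m) smallerLinked found
    ... | x , _ , x<1+y∧x-1+y with Equivalence.to (T-∧ {x <ᵇ suc y}) x<1+y∧x-1+y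
    ...   | x<1+y , x-1+y = subst T (linked-step β y)
                              (proj₂ (linked-split β (s≤s⁻¹ (<ᵇ⇒< x (suc y) x<1+y)) (n≤1+n y) x-1+y))
    from : T (β y) → T (anyBelow (suc m) smallerLinked)
    from βy = anyBelow⁺ smallerLinked (m<n⇒m<1+n y<m)
                (Equivalence.from T-∧ (<⇒<ᵇ (n<1+n y) , subst T (sym (linked-step β y)) βy))

  components-pathSubgraph : components H ≡ suc (countBelow m (not ∘ β))
  components-pathSubgraph = begin
    components H
      ≡⟨ countᵇ-tabulate id isLeast (λ v →
           cong not (any-tabulate id (λ x → (x <ᵇ toℕ v) ∧ linked β x (toℕ v)) λ u →
             cong₂ _∧_ (<?-toℕ u v) (connected-pathSubgraph u v))) ⟩
    countBelow (suc m) isLeast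
      ≡⟨ cong₂ _+_ (cong (𝟙 ∘ not) (anyBelow-false (suc m) λ _ → refl))
                   (countBelow-cong m λ y y<m → cong not (hasSmallerLinked y y<m)) ⟩
    suc (countBelow m (not ∘ β)) ∎
    where
    open ≡-Reasoning
    isLeast : ℕ → Bool
    isLeast y = not (anyBelow (suc m) (λ x → (x <ᵇ y) ∧ linked β x y))

  acyclic-pathSubgraph : acyclic H ≡ true
  acyclic-pathSubgraph = Equivalence.to T-≡ (≡⇒≡ᵇ _ _ edges+components)
    where
    open ≡-Reasoning
    edges+components : length H + components H ≡ suc m
    edges+components = begin
      length H + components H
        ≡⟨ cong₂ _+_ (trans (length-selected (pathGraph (suc m)) S)
                            (cong (λ k → countBelow k β) (length-pathGraph m)))
                     components-pathSubgraph ⟩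
      countBelow m β + suc (countBelow m (not ∘ β))
        ≡⟨ +-suc _ _ ⟩
      suc (countBelow m β + countBelow m (not ∘ β))
        ≡⟨ cong suc (countBelow-complement m β) ⟩
      suc m ∎

-- Rooted forests of the path

-- The roots in the tree of v, where h is an extra root attached to the left of vertex 0.
rootsInTree : Bool → (ℕ → Bool) → (ℕ → Bool) → ℕ → ℕ → ℕ
rootsInTree h β ρ n v = 𝟙 (h ∧ allBelow v β) + countBelow n (λ r → ρ r ∧ linked β v r)

-- Reads the root bit of a vertex and then the bit of the edge to its right; the state h records
-- whether the tree being read already has its root.
wellRooted : Bool → List Bool → List Bool → Bool
wellRooted h [] rs = h xor bit rs 0
wellRooted h (_ ∷ _) [] = false
wellRooted h (true ∷ es) (r ∷ rs) = not (h ∧ r) ∧ wellRooted (h ∨ r) es rs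
wellRooted h (false ∷ es) (r ∷ rs) = (h xor r) ∧ wellRooted false es rs

exactlyOneRoot : ∀ h r → (𝟙 (h ∧ true) + (𝟙 (r ∧ true) + 0) ≡ᵇ 1) ≡ h xor r
exactlyOneRoot true true = refl
exactlyOneRoot true false = refl
exactlyOneRoot false true = refl
exactlyOneRoot false false = refl

wellRooted-correct : ∀ h es rs {n} → length es ≡ n → length rs ≡ suc n →
                     allBelow (suc n) (λ v → rootsInTree h (bit es) (bit rs) (suc n) v ≡ᵇ 1) ≡ wellRooted h es rs
wellRooted-correct h [] (r ∷ []) refl refl = trans (∧-identityʳ _) (exactlyOneRoot h r)
wellRooted-correct h (false ∷ es) (r ∷ rs) refl eq = cong₂ _∧_ firstTree otherTrees
  where
  β = bit (false ∷ es)
  ρ = bit (r ∷ rs)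
  n = suc (length es)
  firstTree : (rootsInTree h β ρ (suc n) 0 ≡ᵇ 1) ≡ h xor r
  firstTree = trans (cong (λ c → (𝟙 (h ∧ true) + (𝟙 (r ∧ true) + c)) ≡ᵇ 1)
                          (countBelow-false n λ k → ∧-zeroʳ (bit rs k)))
                    (exactlyOneRoot h r)
  otherTrees : allBelow n (λ v → rootsInTree h β ρ (suc n) (suc v) ≡ᵇ 1) ≡ wellRooted false es rs
  otherTrees = trans (allBelow-cong n λ v _ → cong (_≡ᵇ 1) (isolated (rootsInTree false (bit es) (bit rs) n v)))
                     (wellRooted-correct false es rs refl (suc-injective eq))
    where
    isolated : ∀ c → 𝟙 (h ∧ false) + (𝟙 (r ∧ false) + c) ≡ c
    isolated c rewrite ∧-zeroʳ h | ∧-zeroʳ r = refl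
-- With edge 0 present, the conditions at the vertices 0 and 1 coincide.
wellRooted-correct false (true ∷ es) (r ∷ rs) refl eq =
  trans (∧-dup (rootsInTree false (bit (true ∷ es)) (bit (r ∷ rs)) (suc (suc (length es))) 0 ≡ᵇ 1) _)
        (wellRooted-correct r es rs refl (suc-injective eq))
wellRooted-correct true (true ∷ es) (false ∷ rs) refl eq =
  trans (∧-dup (rootsInTree true (bit (true ∷ es)) (bit (false ∷ rs)) (suc (suc (length es))) 0 ≡ᵇ 1) _)
        (wellRooted-correct true es rs refl (suc-injective eq))
wellRooted-correct true (true ∷ es) (true ∷ rs) refl _ = refl

isRootedForest-pathGraph : ∀ m S R →
                           isRootedForest (pathGraph (suc m)) (S , R) ≡ wellRooted false (toList S) (toList R)
isRootedForest-pathGraph m S R = begin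
  isRootedForest (pathGraph (suc m)) (S , R)
    ≡⟨ cong₂ _∧_ (acyclic-pathSubgraph m S)
                 (all-tabulate id (λ v → rootsInTree false β ρ (suc m) v ≡ᵇ 1) λ v →
                   cong (_≡ᵇ 1) (countᵇ-tabulate id (λ r → ρ r ∧ linked β (toℕ v) r) λ r →
                     cong₂ _∧_ (lookup-bit R r) (connected-pathSubgraph m S v r))) ⟩
  allBelow (suc m) (λ v → rootsInTree false β ρ (suc m) v ≡ᵇ 1)
    ≡⟨ wellRooted-correct false (toList S) (toList R) (trans (length-toList S) (length-pathGraph m))
                          (length-toList R) ⟩
  wellRooted false (toList S) (toList R) ∎
  where
  open ≡-Reasoning
  β = bit (toList S)
  ρ = bit (toList R)

-- Counting

sumBits : ℕ → (List Bool → ℕ) → ℕ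
sumBits k g = sum (map (g ∘ toList) (allVecs k))

sumBits-suc : ∀ k g → sumBits (suc k) g ≡ sumBits k (g ∘ (true ∷_)) + sumBits k (g ∘ (false ∷_))
sumBits-suc k g = begin
  sum (map (g ∘ toList) (map (true ∷_) (allVecs k) ++ map (false ∷_) (allVecs k)))
    ≡⟨ cong sum (map-++ (g ∘ toList) (map (true ∷_) (allVecs k)) _) ⟩
  sum (map (g ∘ toList) (map (true ∷_) (allVecs k)) ++ map (g ∘ toList) (map (false ∷_) (allVecs k)))
    ≡⟨ sum-++ (map (g ∘ toList) (map (true ∷_) (allVecs k))) _ ⟩
  sum (map (g ∘ toList) (map (true ∷_) (allVecs k))) + sum (map (g ∘ toList) (map (false ∷_) (allVecs k)))
    ≡⟨ cong₂ _+_ (cong sum (sym (map-∘ (allVecs k)))) (cong sum (sym (map-∘ (allVecs k)))) ⟩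
  sumBits k (g ∘ (true ∷_)) + sumBits k (g ∘ (false ∷_)) ∎
  where open ≡-Reasoning

sumBits-cong : ∀ k {g h} → (∀ bs → g bs ≡ h bs) → sumBits k g ≡ sumBits k h
sumBits-cong k g≡h = cong sum (map-cong (g≡h ∘ toList) (allVecs k))

sumBits-+ : ∀ k g h → sumBits k (λ bs → g bs + h bs) ≡ sumBits k g + sumBits k h
sumBits-+ k g h = sum-map-+ (g ∘ toList) (h ∘ toList) (allVecs k)

_⟨_,_⟩ : ∀ {A : Set} → (List Bool → List Bool → A) → Bool → Bool → List Bool → List Bool → A
(F ⟨ e , r ⟩) es rs = F (e ∷ es) (r ∷ rs)

sumBits² : ℕ → ℕ → (List Bool → List Bool → ℕ) → ℕ
sumBits² k n F = sumBits k (λ es → sumBits n (F es))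

sumBits²-cong : ∀ k n {F G} → (∀ es rs → F es rs ≡ G es rs) → sumBits² k n F ≡ sumBits² k n G
sumBits²-cong k n F≡G = sumBits-cong k λ es → sumBits-cong n (F≡G es)

sumBits²-zero : ∀ k n → sumBits² k n (λ _ _ → 0) ≡ 0
sumBits²-zero k n = trans (sumBits-cong k λ _ → sum-map-0 (allVecs n)) (sum-map-0 (allVecs k))

sumBits²-suc : ∀ k n F → sumBits² (suc k) (suc n) F
                         ≡ (sumBits² k n (F ⟨ true , true ⟩) + sumBits² k n (F ⟨ true , false ⟩))
                           + (sumBits² k n (F ⟨ false , true ⟩) + sumBits² k n (F ⟨ false , false ⟩))
sumBits²-suc k n F = begin
  sumBits² (suc k) (suc n) F
    ≡⟨ sumBits-suc k (λ es → sumBits (suc n) (F es)) ⟩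
  sumBits k (λ es → sumBits (suc n) (F (true ∷ es))) + sumBits k (λ es → sumBits (suc n) (F (false ∷ es)))
    ≡⟨ cong₂ _+_ (sumBits-cong k λ es → sumBits-suc n (F (true ∷ es)))
                 (sumBits-cong k λ es → sumBits-suc n (F (false ∷ es))) ⟩
  sumBits k (λ es → Σ (F ⟨ true , true ⟩) es + Σ (F ⟨ true , false ⟩) es)
    + sumBits k (λ es → Σ (F ⟨ false , true ⟩) es + Σ (F ⟨ false , false ⟩) es)
    ≡⟨ cong₂ _+_ (sumBits-+ k (Σ (F ⟨ true , true ⟩)) (Σ (F ⟨ true , false ⟩)))
                 (sumBits-+ k (Σ (F ⟨ false , true ⟩)) (Σ (F ⟨ false , false ⟩))) ⟩
  (sumBits² k n (F ⟨ true , true ⟩) + sumBits² k n (F ⟨ true , false ⟩))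
    + (sumBits² k n (F ⟨ false , true ⟩) + sumBits² k n (F ⟨ false , false ⟩)) ∎
  where
  open ≡-Reasoning
  Σ : (List Bool → List Bool → ℕ) → List Bool → ℕ
  Σ G es = sumBits n (G es)

countᵇ-allVecs² : ∀ k n (p : Vec Bool k × Vec Bool n → Bool) (F : List Bool → List Bool → Bool) →
                  (∀ S R → p (S , R) ≡ F (toList S) (toList R)) →
                  countᵇ p (cartesianProduct (allVecs k) (allVecs n)) ≡ sumBits² k n (λ es rs → 𝟙 (F es rs))
countᵇ-allVecs² k n p F p≡F = begin
  countᵇ p (cartesianProduct (allVecs k) (allVecs n))
    ≡⟨ countᵇ-sum p (cartesianProduct (allVecs k) (allVecs n)) ⟩
  sum (map (𝟙 ∘ p) (cartesianProduct (allVecs k) (allVecs n)))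
    ≡⟨ sum-cartesianProduct (𝟙 ∘ p) (allVecs k) (allVecs n) ⟩
  sum (map (λ S → sum (map (λ R → 𝟙 (p (S , R))) (allVecs n))) (allVecs k))
    ≡⟨ cong sum (map-cong (λ S → cong sum (map-cong (λ R → cong 𝟙 (p≡F S R)) (allVecs n))) (allVecs k)) ⟩
  sumBits² k n (λ es rs → 𝟙 (F es rs)) ∎
  where open ≡-Reasoning

-- countRooted false and countRooted true are f_k and t_k of the proof idea, restricted to Y.
countRooted : Bool → (List Bool → List Bool → Bool) → ℕ → ℕ
countRooted h Y k = sumBits² k (suc k) (λ es rs → 𝟙 (wellRooted h es rs ∧ Y es rs))

countRooted-cong : ∀ h {Y Z} k → (∀ es rs → Y es rs ≡ Z es rs) → countRooted h Y k ≡ countRooted h Z k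
countRooted-cong h k Y≡Z =
  sumBits²-cong k (suc k) λ es rs → cong (λ b → 𝟙 (wellRooted h es rs ∧ b)) (Y≡Z es rs)

countRooted-none : ∀ h {Y} k → (∀ es rs → Y es rs ≡ false) → countRooted h Y k ≡ 0
countRooted-none h k Y≡false =
  trans (sumBits²-cong k (suc k) λ es rs →
           cong 𝟙 (trans (cong (wellRooted h es rs ∧_) (Y≡false es rs)) (∧-zeroʳ _)))
        (sumBits²-zero k (suc k))

countRooted-suc-false : ∀ Y k → countRooted false Y (suc k)
                                ≡ countRooted true (Y ⟨ true , true ⟩) k + countRooted false (Y ⟨ true , false ⟩) k
                                  + countRooted false (Y ⟨ false , true ⟩) k
countRooted-suc-false Y k = begin
  countRooted false Y (suc k)
    ≡⟨ sumBits²-suc k (suc k) (λ es rs → 𝟙 (wellRooted false es rs ∧ Y es rs)) ⟩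
  (tt + tf) + (ft + sumBits² k (suc k) (λ _ _ → 0))
    ≡⟨ cong (λ c → (tt + tf) + (ft + c)) (sumBits²-zero k (suc k)) ⟩
  (tt + tf) + (ft + 0)
    ≡⟨ cong ((tt + tf) +_) (+-identityʳ ft) ⟩
  tt + tf + ft ∎
  where
  open ≡-Reasoning
  tt = countRooted true (Y ⟨ true , true ⟩) k
  tf = countRooted false (Y ⟨ true , false ⟩) k
  ft = countRooted false (Y ⟨ false , true ⟩) k

countRooted-suc-true : ∀ Y k → countRooted true Y (suc k)
                               ≡ countRooted true (Y ⟨ true , false ⟩) k + countRooted false (Y ⟨ false , false ⟩) k
countRooted-suc-true Y k = begin
  countRooted true Y (suc k)
    ≡⟨ sumBits²-suc k (suc k) (λ es rs → 𝟙 (wellRooted true es rs ∧ Y es rs)) ⟩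
  (sumBits² k (suc k) (λ _ _ → 0) + tf) + (sumBits² k (suc k) (λ _ _ → 0) + ff)
    ≡⟨ cong (λ c → (c + tf) + (c + ff)) (sumBits²-zero k (suc k)) ⟩
  tf + ff ∎
  where
  open ≡-Reasoning
  tf = countRooted true (Y ⟨ true , false ⟩) k
  ff = countRooted false (Y ⟨ false , false ⟩) k

fib-2*suc : ∀ a → fib (2 * suc a) ≡ fib (suc (2 * a)) + fib (2 * a)
fib-2*suc a = cong fib (*-suc 2 a)

fib-suc-2*suc : ∀ a → fib (suc (2 * suc a)) ≡ fib (2 * suc a) + fib (suc (2 * a))
fib-suc-2*suc a = trans (cong (fib ∘ suc) (*-suc 2 a)) (cong (_+ fib (suc (2 * a))) (sym (fib-2*suc a)))

fib-2*suc∸1 : ∀ a → fib (2 * suc a ∸ 1) ≡ fib (suc (2 * a))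
fib-2*suc∸1 a = cong (λ n → fib (n ∸ 1)) (*-suc 2 a)

fib-even-step : ∀ a x → fib (2 * a) * x + fib (suc (2 * a)) * x ≡ fib (2 * suc a) * x
fib-even-step a x = begin
  fib (2 * a) * x + fib (suc (2 * a)) * x ≡⟨ *-distribʳ-+ x (fib (2 * a)) _ ⟨
  (fib (2 * a) + fib (suc (2 * a))) * x   ≡⟨ cong (_* x) (trans (+-comm (fib (2 * a)) _) (sym (fib-2*suc a))) ⟩
  fib (2 * suc a) * x                     ∎
  where open ≡-Reasoning

fib-odd-step : ∀ a x → fib (2 * a) * x + fib (suc (2 * a)) * x + fib (suc (2 * a)) * x ≡ fib (suc (2 * suc a)) * x
fib-odd-step a x = begin
  fib (2 * a) * x + fib (suc (2 * a)) * x + fib (suc (2 * a)) * x ≡⟨ cong (_+ fib (suc (2 * a)) * x) (fib-even-step a x) ⟩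
  fib (2 * suc a) * x + fib (suc (2 * a)) * x                     ≡⟨ *-distribʳ-+ x (fib (2 * suc a)) _ ⟨
  (fib (2 * suc a) + fib (suc (2 * a))) * x                       ≡⟨ cong (_* x) (fib-suc-2*suc a) ⟨
  fib (suc (2 * suc a)) * x                                       ∎
  where open ≡-Reasoning

countRooted-all : ∀ k → countRooted false (λ _ _ → true) k ≡ fib (2 * suc k)
                        × countRooted true (λ _ _ → true) k ≡ fib (suc (2 * k))
countRooted-all zero = refl , refl
countRooted-all (suc k) with countRooted-all k
... | false≡ , true≡ =
  (begin
    countRooted false (λ _ _ → true) (suc k) ≡⟨ countRooted-suc-false (λ _ _ → true) k ⟩
    t + f + f                                ≡⟨ cong₂ (λ a b → a + b + b) true≡ false≡ ⟩
    odd + even + even                        ≡⟨ cong (_+ even) (trans (+-comm odd even) (sym (fib-suc-2*suc k))) ⟩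
    fib (suc (2 * suc k)) + even             ≡⟨ fib-2*suc (suc k) ⟨
    fib (2 * suc (suc k))                    ∎)
  , (begin
    countRooted true (λ _ _ → true) (suc k) ≡⟨ countRooted-suc-true (λ _ _ → true) k ⟩
    t + f                                   ≡⟨ cong₂ _+_ true≡ false≡ ⟩
    odd + even                              ≡⟨ trans (+-comm odd even) (sym (fib-suc-2*suc k)) ⟩
    fib (suc (2 * suc k))                   ∎)
  where
  open ≡-Reasoning
  t = countRooted true (λ _ _ → true) k
  f = countRooted false (λ _ _ → true) k
  odd = fib (suc (2 * k))
  even = fib (2 * suc k)

countRooted-firstEdges : ∀ c k → c ≤ k →
                         countRooted true (λ es _ → allBelow c (bit es)) k ≡ fib (suc (2 * (k ∸ c)))
countRooted-firstEdges zero k _ = proj₂ (countRooted-all k)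
countRooted-firstEdges (suc c) (suc k) (s≤s c≤k) = begin
  countRooted true (λ es _ → allBelow (suc c) (bit es)) (suc k)
    ≡⟨ countRooted-suc-true (λ es _ → allBelow (suc c) (bit es)) k ⟩
  countRooted true (λ es _ → allBelow c (bit es)) k + countRooted false (λ _ _ → false) k
    ≡⟨ cong₂ _+_ (countRooted-firstEdges c k c≤k) (countRooted-none false k λ _ _ → refl) ⟩
  fib (suc (2 * (k ∸ c))) + 0
    ≡⟨ +-identityʳ _ ⟩
  fib (suc (2 * (k ∸ c))) ∎
  where open ≡-Reasoning

rootedAt : ℕ → ℕ → List Bool → List Bool → Bool
rootedAt i j es rs = bit rs i ∧ linked (bit es) i j

countRooted-rootAtFirst : ∀ j k → j ≤ k → countRooted false (rootedAt 0 j) k ≡ fib (suc (2 * (k ∸ j)))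
                                           × countRooted true (rootedAt 0 j) k ≡ 0
countRooted-rootAtFirst zero zero _ = refl , refl
countRooted-rootAtFirst j (suc k) j≤1+k =
  withFirstRoot j j≤1+k ,
  trans (countRooted-suc-true (rootedAt 0 j) k)
        (cong₂ _+_ (countRooted-none true k λ _ _ → refl) (countRooted-none false k λ _ _ → refl))
  where
  open ≡-Reasoning
  withFirstRoot : ∀ j → j ≤ suc k → countRooted false (rootedAt 0 j) (suc k) ≡ fib (suc (2 * (suc k ∸ j)))
  withFirstRoot zero _ = begin
    countRooted false (rootedAt 0 0) (suc k)
      ≡⟨ countRooted-suc-false (rootedAt 0 0) k ⟩
    countRooted true (λ _ _ → true) k + countRooted false (λ _ _ → false) k + countRooted false (λ _ _ → true) k
      ≡⟨ cong₂ (λ t n → t + n + countRooted false (λ _ _ → true) k)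
               (proj₂ (countRooted-all k)) (countRooted-none false k λ _ _ → refl) ⟩
    fib (suc (2 * k)) + 0 + countRooted false (λ _ _ → true) k
      ≡⟨ cong₂ _+_ (+-identityʳ _) (proj₁ (countRooted-all k)) ⟩
    fib (suc (2 * k)) + fib (2 * suc k)
      ≡⟨ trans (+-comm (fib (suc (2 * k))) _) (sym (fib-suc-2*suc k)) ⟩
    fib (suc (2 * suc k)) ∎
  withFirstRoot (suc j) (s≤s j≤k) = begin
    countRooted false (rootedAt 0 (suc j)) (suc k)
      ≡⟨ countRooted-suc-false (rootedAt 0 (suc j)) k ⟩
    countRooted true (λ es _ → allBelow j (bit es)) k + countRooted false (λ _ _ → false) k
      + countRooted false (λ _ _ → false) k
      ≡⟨ cong₂ (λ t n → t + n + n) (countRooted-firstEdges j k j≤k) (countRooted-none false k λ _ _ → refl) ⟩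
    fib (suc (2 * (k ∸ j))) + 0 + 0
      ≡⟨ trans (+-identityʳ _) (+-identityʳ _) ⟩
    fib (suc (2 * (k ∸ j))) ∎

countRooted-treeOfFirst : ∀ i k → i ≤ k → countRooted false (rootedAt i 0) k ≡ fib (suc (2 * (k ∸ i)))
                                           × countRooted true (rootedAt i 0) k ≡ 0
countRooted-treeOfFirst zero k _ = countRooted-rootAtFirst 0 k z≤n
countRooted-treeOfFirst (suc i) (suc k) (s≤s i≤k) with countRooted-treeOfFirst i k i≤k
... | false≡ , true≡ =
  (begin
    countRooted false (rootedAt (suc i) 0) (suc k)
      ≡⟨ countRooted-suc-false (rootedAt (suc i) 0) k ⟩
    countRooted true (rootedAt (suc i) 0 ⟨ true , true ⟩) k
      + countRooted false (rootedAt (suc i) 0 ⟨ true , false ⟩) k + rest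
      ≡⟨ cong₂ (λ t f → t + f + rest) (shift true true) (shift false false) ⟩
    countRooted true (rootedAt i 0) k + countRooted false (rootedAt i 0) k + rest
      ≡⟨ cong₂ (λ t c → t + countRooted false (rootedAt i 0) k + c) true≡ (countRooted-none false k (cut {true})) ⟩
    countRooted false (rootedAt i 0) k + 0
      ≡⟨ trans (+-identityʳ _) false≡ ⟩
    fib (suc (2 * (k ∸ i))) ∎)
  , trans (countRooted-suc-true (rootedAt (suc i) 0) k)
          (cong₂ _+_ (trans (shift true false) true≡) (countRooted-none false k (cut {false})))
  where
  open ≡-Reasoning
  rest = countRooted false (rootedAt (suc i) 0 ⟨ false , true ⟩) k
  shift : ∀ h r → countRooted h (rootedAt (suc i) 0 ⟨ true , r ⟩) k ≡ countRooted h (rootedAt i 0) k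
  shift h r = countRooted-cong h k λ es rs → cong (bit rs i ∧_) (sym (linked-zeroʳ (bit es) i))
  cut : ∀ {r} es rs → (rootedAt (suc i) 0 ⟨ false , r ⟩) es rs ≡ false
  cut es rs = ∧-zeroʳ (bit rs i)

countRooted-rootedAt : ∀ i j k → i ≤ k → j ≤ k →
  countRooted false (rootedAt i j) k ≡ fib (suc (2 * (i ⊓ j))) * fib (suc (2 * (k ∸ (i ⊔ j))))
  × countRooted true (rootedAt i j) k ≡ fib (2 * (i ⊓ j)) * fib (suc (2 * (k ∸ (i ⊔ j))))
countRooted-rootedAt zero j k _ j≤k with countRooted-rootAtFirst j k j≤k
... | false≡ , true≡ = trans false≡ (sym (*-identityˡ _)) , true≡
countRooted-rootedAt (suc i) zero k i≤k _ with countRooted-treeOfFirst (suc i) k i≤k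
... | false≡ , true≡ = trans false≡ (sym (*-identityˡ _)) , true≡
countRooted-rootedAt (suc i) (suc j) (suc k) (s≤s i≤k) (s≤s j≤k) with countRooted-rootedAt i j k i≤k j≤k
... | false≡ , true≡ =
  trans (countRooted-suc-false (rootedAt (suc i) (suc j)) k)
        (trans (cong₂ (λ t f → t + f + f) true≡ false≡) (fib-odd-step (i ⊓ j) _))
  , trans (countRooted-suc-true (rootedAt (suc i) (suc j)) k)
          (trans (cong₂ _+_ true≡ false≡) (fib-even-step (i ⊓ j) _))

forestCount-pathGraph : ∀ m → forestCount (pathGraph (suc m)) ≡ countRooted false (λ _ _ → true) m
forestCount-pathGraph m = begin
  forestCount G
    ≡⟨ countᵇ-allVecs² (length G) (suc m) _ (λ es rs → wellRooted false es rs ∧ true)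
         (λ S R → trans (isRootedForest-pathGraph m S R) (sym (∧-identityʳ _))) ⟩
  sumBits² (length G) (suc m) (λ es rs → 𝟙 (wellRooted false es rs ∧ true))
    ≡⟨ cong (λ k → sumBits² k (suc m) (λ es rs → 𝟙 (wellRooted false es rs ∧ true))) (length-pathGraph m) ⟩
  countRooted false (λ _ _ → true) m ∎
  where
  open ≡-Reasoning
  G = pathGraph (suc m)

forestCountAt-pathGraph : ∀ m (i j : Fin (suc m)) →
                          forestCountAt (pathGraph (suc m)) i j ≡ countRooted false (rootedAt (toℕ i) (toℕ j)) m
forestCountAt-pathGraph m i j = begin
  forestCountAt G i j
    ≡⟨ countᵇ-filterᵇ (isRootedForest G) rootedAtᵢ∧linkedⱼ candidates ⟩
  countᵇ (λ c → isRootedForest G c ∧ rootedAtᵢ∧linkedⱼ c) candidates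
    ≡⟨ countᵇ-allVecs² (length G) (suc m) _ (λ es rs → wellRooted false es rs ∧ rootedAt (toℕ i) (toℕ j) es rs)
         (λ S R → cong₂ _∧_ (isRootedForest-pathGraph m S R)
                            (cong₂ _∧_ (lookup-bit R i) (connected-pathSubgraph m S i j))) ⟩
  sumBits² (length G) (suc m) summand
    ≡⟨ cong (λ k → sumBits² k (suc m) summand) (length-pathGraph m) ⟩
  countRooted false (rootedAt (toℕ i) (toℕ j)) m ∎
  where
  open ≡-Reasoning
  G = pathGraph (suc m)
  candidates = cartesianProduct (allVecs (length G)) (allVecs (suc m))
  summand : List Bool → List Bool → ℕ
  summand es rs = 𝟙 (wellRooted false es rs ∧ rootedAt (toℕ i) (toℕ j) es rs)
  rootedAtᵢ∧linkedⱼ : Candidate G → Bool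
  rootedAtᵢ∧linkedⱼ c = lookup (proj₂ c) i ∧ connected (selected G (proj₁ c)) i j

theorem1 : (n : ℕ) → 2 ≤ n →
    (forestCount (pathGraph n) ≡ fib (2 * n))
    × ((i j : Fin n) →
        forestCountAt (pathGraph n) i j
          ≡ fib (2 * (suc (toℕ i) ⊓ suc (toℕ j)) ∸ 1)
            * fib (2 * (suc n ∸ (suc (toℕ i) ⊔ suc (toℕ j))) ∸ 1))
theorem1 (suc m) _ = trans (forestCount-pathGraph m) (proj₁ (countRooted-all m)) , λ i j → begin
  forestCountAt (pathGraph (suc m)) i j
    ≡⟨ forestCountAt-pathGraph m i j ⟩
  countRooted false (rootedAt (toℕ i) (toℕ j)) m
    ≡⟨ proj₁ (countRooted-rootedAt (toℕ i) (toℕ j) m (s≤s⁻¹ (toℕ<n i)) (s≤s⁻¹ (toℕ<n j))) ⟩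
  fib (suc (2 * (toℕ i ⊓ toℕ j))) * fib (suc (2 * (m ∸ (toℕ i ⊔ toℕ j))))
    ≡⟨ cong₂ _*_ (fib-2*suc∸1 (toℕ i ⊓ toℕ j))
                 (trans (cong (λ d → fib (2 * d ∸ 1)) (+-∸-assoc 1 (⊔-below i j)))
                        (fib-2*suc∸1 (m ∸ (toℕ i ⊔ toℕ j)))) ⟨
  fib (2 * (suc (toℕ i) ⊓ suc (toℕ j)) ∸ 1) * fib (2 * (suc (suc m) ∸ (suc (toℕ i) ⊔ suc (toℕ j))) ∸ 1) ∎
  where
  open ≡-Reasoning
  ⊔-below : ∀ (i j : Fin (suc m)) → toℕ i ⊔ toℕ j ≤ m
  ⊔-below i j = ⊔-lub (s≤s⁻¹ (toℕ<n i)) (s≤s⁻¹ (toℕ<n j))
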